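{- Let $T$ be an indecomposable tournament. If a diamond embeds into $T$ and $T_{5}$ embeds into $T$, then $U_{5}$ and $W_{5}$ embed into $T$.
   Context: A tournament $T=(V,A)$ is a finite vertex set $V$ with an arc set $A$ of ordered pairs of distinct vertices such that for distinct $x,y\in V$, exactly one of $(x,y),(y,x)$ lies in $A$; write $x\to y$ for $(x,y)\in A$. For $X\subseteq V$, $T(X)$ is the induced subtournament on $X$. A tournament $T'$ embeds into $T$ if $T'$ is isomorphic to a subtournament of $T$. A subset $I\subseteq V$ is an interval of $T$ if for every $x\in V\setminus I$, either $x\to y$ for all $y\in I$ or $y\to x$ for all $y\in I$. The sets $\emptyset$, $V$ and singletons are trivial intervals; $T$ is indecomposable if all its intervals are trivial. A diamond is a tournament on 4 vertices having exactly one interval of cardinality 3. For $n\ge 2$: $T_{2n+1}$ is the tournament on $\mathbb{Z}/(2n+1)\mathbb{Z}$ with arcs $\{(i,j): j-i\in\{1,\dots,n\}\}$; $U_{2n+1}$ is obtained from $T_{2n+1}$ (on vertex set $\{0,\dots,2n\}$) by reversing all arcs between vertices of $\{n+1,\dots,2n\}$; $W_{2n+1}$ is the tournament on $\{0,\dots,2n\}$ such that for $0\le i<j\le 2n-1$ we have $i\to j$, and $2i+1\to 2n\to 2i$ for $0\le i\le n-1$. -}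

module Defs where

open import Data.Nat using (ℕ; zero; suc; _+_; _*_; _∸_; _%_; _<ᵇ_; _≡ᵇ_)
open import Data.Nat.Properties using ()
open import Data.Bool using (Bool; true; false; not; _∧_; _∨_; if_then_else_)
open import Data.Fin using (Fin; toℕ)
open import Data.Fin.Subset using (Subset; _∈_; _∉_; ⊥; ⊤; ⁅_⁆; ∣_∣)
open import Data.Product using (Σ; ∃; _×_; _,_)
open import Data.Sum using (_⊎_)
open import Relation.Binary.PropositionalEquality using (_≡_; _≢_)
open import Function.Definitions using (Injective)

record Tournament (n : ℕ) : Set where
  field
    arc    : Fin n → Fin n → Bool
    irrefl : ∀ x → arc x x ≡ false
    total  : ∀ x y → x ≢ y → arc y x ≡ not (arc x y)
open Tournament public

Embeds : {m n : ℕ} → (Fin m → Fin m → Bool) → Tournament n → Set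
Embeds {m} {n} a T =
  Σ (Fin m → Fin n) λ f → Injective _≡_ _≡_ f × (∀ i j → arc T (f i) (f j) ≡ a i j)

IsInterval : {n : ℕ} → Tournament n → Subset n → Set
IsInterval {n} T I = ∀ x → x ∉ I →
  (∀ y → y ∈ I → arc T x y ≡ true) ⊎ (∀ y → y ∈ I → arc T y x ≡ true)

IsTrivial : {n : ℕ} → Subset n → Set
IsTrivial {n} I = (I ≡ ⊥) ⊎ (I ≡ ⊤) ⊎ (∃ λ x → I ≡ ⁅ x ⁆)

Indecomposable : {n : ℕ} → Tournament n → Set
Indecomposable {n} T = ∀ I → IsInterval T I → IsTrivial I

IsDiamond : Tournament 4 → Set
IsDiamond D = Σ (Subset 4) λ I → IsInterval D I × ∣ I ∣ ≡ 3 ×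
  (∀ J → IsInterval D J → ∣ J ∣ ≡ 3 → J ≡ I)

DiamondEmbeds : {n : ℕ} → Tournament n → Set
DiamondEmbeds T = Σ (Tournament 4) λ D → IsDiamond D × Embeds (arc D) T

-- T_{2n+1} on {0,…,2n} (= Z/(2n+1)Z): i → j iff (j - i) mod (2n+1) ∈ {1,…,n}
arcT : (n : ℕ) → Fin (suc (2 * n)) → Fin (suc (2 * n)) → Bool
arcT n i j = (0 <ᵇ d) ∧ (d <ᵇ suc n)
  where
    d : ℕ
    d = (toℕ j + suc (2 * n) ∸ toℕ i) % suc (2 * n)

arcU : (n : ℕ) → Fin (suc (2 * n)) → Fin (suc (2 * n)) → Bool
arcU n i j = if (n <ᵇ toℕ i) ∧ (n <ᵇ toℕ j) then arcT n j i else arcT n i j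

isOdd : ℕ → Bool
isOdd zero = false
isOdd (suc k) = not (isOdd k)

-- W_{2n+1}: i → j for 0 ≤ i < j ≤ 2n-1, and 2i+1 → 2n → 2i for 0 ≤ i ≤ n-1
arcW : (n : ℕ) → Fin (suc (2 * n)) → Fin (suc (2 * n)) → Bool
arcW n i j with toℕ i ≡ᵇ 2 * n | toℕ j ≡ᵇ 2 * n
... | true  | true  = false
... | true  | false = not (isOdd (toℕ j))
... | false | true  = isOdd (toℕ i)
... | false | false = toℕ i <ᵇ toℕ j

module Submission where

-- Fix a copy X of T₅ in T. By finite checks, every vertex u outside X either can replace some
-- vertex x_s of X (u is a twin of x_s: it is joined to the other four vertices like x_s), or is
-- joined to all of X in one direction, or already spans a copy of F ∈ {U₅, W₅} together with X;
-- similar checks govern pairs of outside vertices. Suppose T contains no copy of F. Then no vertex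
-- is joined to X in one direction, for otherwise the union of the twin classes would be a
-- nontrivial interval; and no twin class with two members is an interval. A diamond yields a
-- directed triangle c₁ → c₂ → c₃ → c₁ and a vertex d joined to it in one direction. Replacing
-- vertices of X by twins, each time shrinking the twin class that contains the triangle, we obtain
-- a copy of T₅ through all of c₁, c₂, c₃. But d is a twin of some vertex of that copy, and no twin
-- pattern is constant on a directed triangle of T₅. Since containing F is decidable, T contains F.

open import Defs
open import Data.Bool using (Bool; true; false; not) renaming (_≟_ to _≟ᵇ_)
open import Data.Bool.Properties using (¬-not)
open import Data.Empty using (⊥-elim) renaming (⊥ to Empty)
open import Data.Fin using (Fin; zero; suc; _≟_)
open import Data.Fin.Patterns using (0F; 1F; 2F; 3F; 4F; 5F; 6F)
open import Data.Fin.Properties using (all?; any?; ¬∀⟶∃¬)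
open import Data.Fin.Subset using (Subset; _∈_; _∉_; _⊂_; ∁; ⁅_⁆; ∣_∣)
open import Data.Fin.Subset.Properties
  using (_∈?_; anySubset?; ∉⊥; ∈⊤; x∈⁅x⁆; x∈⁅y⁆⇒x≡y; x∈p⇒x∉∁p; x∉∁p⇒x∈p; p⊂q⇒∣p∣<∣q∣)
open import Data.Nat using (ℕ; _<_) renaming (_≟_ to _≟ℕ_)
open import Data.Nat.Induction using (<-wellFounded)
open import Data.Product using (∃; Σ; _×_; _,_; proj₁; proj₂)
open import Data.Sum using (_⊎_; inj₁; inj₂; map₂)
open import Data.Vec using (tabulate)
open import Data.Vec.Functional using (_∷_; []; updateAt)
open import Data.Vec.Functional.Properties using (updateAt-updates; updateAt-minimal)
open import Data.Vec.Properties using (lookup∘tabulate; []=⇒lookup; lookup⇒[]=; ≡-dec)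
open import Function using (id; const; _∘_; case_of_)
open import Function.Definitions using (Injective)
open import Induction.WellFounded using (Acc; acc)
open import Level using (0ℓ)
open import Relation.Binary.PropositionalEquality using (_≡_; _≢_; _≗_; refl; sym; trans; cong; cong₂; subst)
open import Relation.Nullary using (Dec; does; ¬_; ¬?; yes; no)
open import Relation.Nullary.Decidable
  using (True; map′; _×-dec_; _⊎-dec_; _→-dec_; dec-true; from-yes; from-no; toWitness; decidable-stable)
open import Relation.Unary using (Pred; Decidable)

private variable
  m n : ℕ

Arcs : ℕ → Set
Arcs m = Fin m → Fin m → Bool

record _↪_ (a : Arcs m) (b : Arcs n) : Set where
  constructor embedding
  field
    vertex    : Fin m → Fin n
    injective : Injective _≡_ _≡_ vertex
    preserves : ∀ i j → b (vertex i) (vertex j) ≡ a i j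
open _↪_ public

infix 4 _↪_

↪-refl : {a : Arcs m} → a ↪ a
↪-refl = embedding id id (λ _ _ → refl)

↪-trans : ∀ {k} {a : Arcs k} {b : Arcs m} {c : Arcs n} → a ↪ b → b ↪ c → a ↪ c
↪-trans (embedding f f-inj f-arc) (embedding g g-inj g-arc) =
  embedding (g ∘ f) (f-inj ∘ g-inj) (λ i j → trans (g-arc (f i) (f j)) (f-arc i j))

↪-resp : {a : Arcs m} {b b′ : Arcs n} → (∀ i j → b i j ≡ b′ i j) → a ↪ b → a ↪ b′
↪-resp b≗b′ (embedding f f-inj f-arc) = embedding f f-inj (λ i j → trans (sym (b≗b′ (f i) (f j))) (f-arc i j))

↪⇒Embeds : {a : Arcs m} {T : Tournament n} → a ↪ arc T → Embeds a T
↪⇒Embeds (embedding f f-inj f-arc) = f , f-inj , f-arc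

Embeds⇒↪ : {a : Arcs m} {T : Tournament n} → Embeds a T → a ↪ arc T
Embeds⇒↪ (f , f-inj , f-arc) = embedding f f-inj f-arc

-- The new vertex is zero.
extend : Arcs n → (Fin n → Bool) → Arcs (ℕ.suc n)
extend a p zero    zero    = false
extend a p zero    (suc j) = p j
extend a p (suc i) zero    = not (p i)
extend a p (suc i) (suc j) = a i j

extend-cong : (a : Arcs n) {p q : Fin n → Bool} → p ≗ q → ∀ i j → extend a p i j ≡ extend a q i j
extend-cong a p≗q zero    zero    = refl
extend-cong a p≗q zero    (suc j) = p≗q j
extend-cong a p≗q (suc i) zero    = cong not (p≗q i)
extend-cong a p≗q (suc i) (suc j) = refl

module _ (T : Tournament n) where

  arc⇒≢ : ∀ {x y} → arc T x y ≡ true → x ≢ y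
  arc⇒≢ {x} x→y refl with () ← trans (sym x→y) (irrefl T x)

  arc-converse : ∀ {x y} → x ≢ y → arc T x y ≡ false → arc T y x ≡ true
  arc-converse {x} {y} x≢y x↛y = trans (total T x y x≢y) (cong not x↛y)

  arc-asym : ∀ {x y} → arc T x y ≡ true → arc T y x ≡ false
  arc-asym x→y = trans (total T _ _ (arc⇒≢ x→y)) (cong not x→y)

  one-sided : ∀ {z c} {P : Fin n → Set} → (∀ {y} → P y → z ≢ y) → (∀ {y} → P y → arc T z y ≡ c) →
              (∀ y → P y → arc T z y ≡ true) ⊎ (∀ y → P y → arc T y z ≡ true)
  one-sided {c = true}  z≢ z→ = inj₁ λ y Py → z→ Py
  one-sided {c = false} z≢ z→ = inj₂ λ y Py → arc-converse (z≢ Py) (z→ Py)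

  extend-↪ : {a : Arcs m} {p : Fin m → Bool} (X : a ↪ arc T) (v : Fin n) →
             (∀ k → vertex X k ≢ v) → (∀ k → arc T v (vertex X k) ≡ p k) → extend a p ↪ arc T
  extend-↪ {a = a} {p} X v v-new v-arc = embedding (v ∷ vertex X) inj arcs
    where
    inj : Injective _≡_ _≡_ (v ∷ vertex X)
    inj {zero}  {zero}  _  = refl
    inj {zero}  {suc j} eq = ⊥-elim (v-new j (sym eq))
    inj {suc i} {zero}  eq = ⊥-elim (v-new i eq)
    inj {suc i} {suc j} eq = cong suc (injective X eq)
    arcs : ∀ i j → arc T ((v ∷ vertex X) i) ((v ∷ vertex X) j) ≡ extend a p i j
    arcs zero    zero    = irrefl T v
    arcs zero    (suc j) = v-arc j
    arcs (suc i) zero    = trans (total T v (vertex X i) (v-new i ∘ sym)) (cong not (v-arc i))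
    arcs (suc i) (suc j) = preserves X i j

  replace : (A : Tournament m) (X : arc A ↪ arc T) {s : Fin m} {u : Fin n} →
            (∀ k → k ≢ s → arc T u (vertex X k) ≡ arc A s k) → (∀ k → k ≢ s → vertex X k ≢ u) →
            arc A ↪ arc T
  replace A X {s} {u} u-arc u-new = embedding x′ inj arcs
    where
    x′ : Fin _ → Fin n
    x′ = updateAt (vertex X) s (const u)
    at-s : x′ s ≡ u
    at-s = updateAt-updates s (vertex X)
    off-s : ∀ {k} → k ≢ s → x′ k ≡ vertex X k
    off-s k≢s = updateAt-minimal _ s (vertex X) k≢s
    inj : Injective _≡_ _≡_ x′
    inj {i} {j} eq with i ≟ s | j ≟ s
    ... | yes refl | yes refl = refl
    ... | yes refl | no j≢s   = ⊥-elim (u-new j j≢s (trans (sym (off-s j≢s)) (trans (sym eq) at-s)))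
    ... | no i≢s   | yes refl = ⊥-elim (u-new i i≢s (trans (sym (off-s i≢s)) (trans eq at-s)))
    ... | no i≢s   | no j≢s   = injective X (trans (sym (off-s i≢s)) (trans eq (off-s j≢s)))
    arcs : ∀ i j → arc T (x′ i) (x′ j) ≡ arc A i j
    arcs i j with i ≟ s | j ≟ s
    ... | yes refl | yes refl rewrite at-s = trans (irrefl T u) (sym (irrefl A i))
    ... | yes refl | no j≢s   rewrite at-s | off-s j≢s = u-arc j j≢s
    ... | no i≢s   | yes refl rewrite at-s | off-s i≢s =
      trans (total T u (vertex X i) (u-new i i≢s ∘ sym))
            (trans (cong not (u-arc i i≢s)) (sym (total A j i (i≢s ∘ sym))))
    ... | no i≢s   | no j≢s   rewrite off-s i≢s | off-s j≢s = preserves X i j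

∀-Bool? : {P : Bool → Set} → Decidable P → Dec (∀ b → P b)
∀-Bool? P? = map′ (λ { (f , t) false → f ; (f , t) true → t }) (λ h → h false , h true)
                  (P? false ×-dec P? true)

∃-map? : {P : (Fin m → Fin n) → Set} → (∀ {f g} → f ≗ g → P f → P g) → Decidable P → Dec (∃ P)
∃-map? {ℕ.zero}  resp P? = map′ (_ ,_) (λ (f , pf) → resp (λ ()) pf) (P? (λ ()))
∃-map? {ℕ.suc m} resp P? =
  map′ (λ (i , f , pf) → i ∷ f , pf)
       (λ (f , pf) → f zero , f ∘ suc , resp (λ { zero → refl ; (suc k) → refl }) pf)
       (any? λ i → ∃-map? (λ f≗g → resp λ { zero → refl ; (suc k) → f≗g k }) (P? ∘ (i ∷_)))

counterexample : {P Q : Fin n → Set} → Decidable P → Decidable Q →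
                 ¬ (∀ y → P y → Q y) → ∃ λ y → P y × ¬ Q y
counterexample {n} P? Q? ¬P⇒Q with ¬∀⟶∃¬ n _ (λ y → P? y →-dec Q? y) ¬P⇒Q
... | y , ¬Py⇒Qy with P? y
...   | yes Py = y , Py , λ Qy → ¬Py⇒Qy (const Qy)
...   | no ¬Py = ⊥-elim (¬Py⇒Qy (⊥-elim ∘ ¬Py))

injective? : (g : Fin m → Fin n) → Dec (Injective _≡_ _≡_ g)
injective? g = map′ (λ h {i} {j} → h i j) (λ h i j → h) (all? λ i → all? λ j → g i ≟ g j →-dec i ≟ j)

Embedding-via : Arcs m → Arcs n → (Fin m → Fin n) → Set
Embedding-via a b g = Injective _≡_ _≡_ g × (∀ i j → b (g i) (g j) ≡ a i j)

via : {a : Arcs m} {b : Arcs n} {g : Fin m → Fin n} → Embedding-via a b g → a ↪ b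
via (g-inj , g-arc) = embedding _ g-inj g-arc

embedding? : (a : Arcs m) (b : Arcs n) (g : Fin m → Fin n) → Dec (Embedding-via a b g)
embedding? a b g = injective? g ×-dec all? λ i → all? λ j → b (g i) (g j) ≟ᵇ a i j

_↪?_ : (a : Arcs m) (b : Arcs n) → Dec (a ↪ b)
a ↪? b = map′ (λ (f , f-emb) → via f-emb) (λ (embedding f f-inj f-arc) → f , (λ {i} {j} → f-inj) , f-arc)
              (∃-map? respects (embedding? a b))
  where
  respects : ∀ {f g} → f ≗ g → Embedding-via a b f → Embedding-via a b g
  respects f≗g (f-inj , f-arc) =
    (λ {i} {j} eq → f-inj (trans (f≗g i) (trans eq (sym (f≗g j))))) ,
    (λ i j → trans (sym (cong₂ b (f≗g i) (f≗g j))) (f-arc i j))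

⟦_⟧ : {P : Pred (Fin n) 0ℓ} → Decidable P → Subset n
⟦ P? ⟧ = tabulate (does ∘ P?)

module _ {P : Pred (Fin n) 0ℓ} (P? : Decidable P) where

  ∈⟦⟧⁺ : ∀ {x} → P x → x ∈ ⟦ P? ⟧
  ∈⟦⟧⁺ {x} Px = lookup⇒[]= x ⟦ P? ⟧ (trans (lookup∘tabulate _ x) (dec-true (P? x) Px))

  ∈⟦⟧⁻ : ∀ {x} → x ∈ ⟦ P? ⟧ → P x
  ∈⟦⟧⁻ {x} x∈ with P? x | trans (sym (lookup∘tabulate (does ∘ P?) x)) ([]=⇒lookup x∈)
  ... | yes Px | _ = Px

¬IsTrivial : {I : Subset n} {a b c : Fin n} → a ∈ I → b ∈ I → a ≢ b → c ∉ I → ¬ IsTrivial I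
¬IsTrivial a∈I b∈I a≢b c∉I (inj₁ refl)              = ∉⊥ a∈I
¬IsTrivial a∈I b∈I a≢b c∉I (inj₂ (inj₁ refl))       = c∉I ∈⊤
¬IsTrivial a∈I b∈I a≢b c∉I (inj₂ (inj₂ (x , refl))) = a≢b (trans (x∈⁅y⁆⇒x≡y x a∈I) (sym (x∈⁅y⁆⇒x≡y x b∈I)))

-- The tournament T₅ and twins of its vertices

t₅ : Arcs 5
t₅ = arcT 2

T₅ : Tournament 5
T₅ = record
  { arc    = t₅
  ; irrefl = from-yes (all? λ x → t₅ x x ≟ᵇ false)
  ; total  = from-yes (all? λ x → all? λ y → ¬? (x ≟ y) →-dec t₅ y x ≟ᵇ not (t₅ x y))
  }

IsTwin : (Fin 5 → Bool) → Fin 5 → Set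
IsTwin p s = ∀ k → k ≢ s → p k ≡ t₅ s k

isTwin? : ∀ p s → Dec (IsTwin p s)
isTwin? p s = all? λ k → ¬? (k ≟ s) →-dec p k ≟ᵇ t₅ s k

-- The profile of a twin of s which has the arc β towards s itself.
twin : Fin 5 → Bool → Fin 5 → Bool
twin s β = updateAt (t₅ s) s (const β)

IsTwin⇒twin : ∀ {p s} → IsTwin p s → p ≗ twin s (p s)
IsTwin⇒twin {p} {s} p-twin k with k ≟ s
... | yes refl = sym (updateAt-updates s (t₅ s))
... | no k≢s   = trans (p-twin k k≢s) (sym (updateAt-minimal k s (t₅ s) k≢s))

t₅-twin-free : ∀ s t → s ≢ t → ¬ (∀ k → k ≢ s → k ≢ t → t₅ s k ≡ t₅ t k)
t₅-twin-free = from-yes (all? λ s → all? λ t → ¬? (s ≟ t) →-dec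
  ¬? (all? λ k → ¬? (k ≟ s) →-dec ¬? (k ≟ t) →-dec t₅ s k ≟ᵇ t₅ t k))

constant-not-twin : ∀ c s → ¬ IsTwin (const c) s
constant-not-twin = from-yes (∀-Bool? λ c → all? λ s → ¬? (isTwin? (const c) s))

twin-not-constant-on-triangle : ∀ k γ p q r β →
  ¬ (t₅ p q ≡ true × t₅ q r ≡ true × t₅ r p ≡ true × twin k γ p ≡ β × twin k γ q ≡ β × twin k γ r ≡ β)
twin-not-constant-on-triangle = from-yes
  (all? λ k → ∀-Bool? λ γ → all? λ p → all? λ q → all? λ r → ∀-Bool? λ β →
    ¬? (t₅ p q ≟ᵇ true ×-dec t₅ q r ≟ᵇ true ×-dec t₅ r p ≟ᵇ true ×-dec
        twin k γ p ≟ᵇ β ×-dec twin k γ q ≟ᵇ β ×-dec twin k γ r ≟ᵇ β))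

-- T₅ extended by a vertex y with profile p and then a vertex z with profile q, where e is the arc
-- from y to z; z has index 0, y index 1 and the vertex k of T₅ index k + 2.
extend₂ : (p q : Fin 5 → Bool) → Bool → Arcs 7
extend₂ p q e = extend (extend t₅ p) (not e ∷ q)

_+3 : Fin 5 → Fin 5
0F +3 = 3F
1F +3 = 4F
2F +3 = 0F
3F +3 = 1F
4F +3 = 2F

+3-injective : ∀ {i j} → i +3 ≡ j +3 → i ≡ j
+3-injective {i} {j} = from-yes (all? λ i → all? λ j → i +3 ≟ j +3 →-dec i ≟ j) i j

-- The pairs of twins y of i and z of j (with profiles twin i β, twin j γ and the arc e from y to z)
-- that are not joined like i and j, yet lie on a common copy of T₅ (see exceptional-spans).
Exceptional : Fin 5 → Bool → Fin 5 → Bool → Bool → Set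
Exceptional i β j γ e = (j ≡ i +3 × β ≡ false × γ ≡ true × e ≡ true)
                      ⊎ (i ≡ j +3 × β ≡ true × γ ≡ false × e ≡ false)

exceptional? : ∀ i β j γ e → Dec (Exceptional i β j γ e)
exceptional? i β j γ e =
  (j ≟ i +3 ×-dec β ≟ᵇ false ×-dec γ ≟ᵇ true ×-dec e ≟ᵇ true) ⊎-dec
  (i ≟ j +3 ×-dec β ≟ᵇ true ×-dec γ ≟ᵇ false ×-dec e ≟ᵇ false)

exceptional-unique : ∀ {i j k β β′ γ e e′} → Exceptional i β k γ e → Exceptional j β′ k γ e′ → i ≡ j
exceptional-unique (inj₁ (k≡i+3 , _ , refl , _)) (inj₁ (k≡j+3 , _ , _ , _)) = +3-injective (trans (sym k≡i+3) k≡j+3)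
exceptional-unique (inj₂ (i≡k+3 , _ , refl , _)) (inj₂ (j≡k+3 , _ , _ , _)) = trans i≡k+3 (sym j≡k+3)

spanning-forward : Fin 5 → Fin 5 → Fin 7
spanning-forward 0F = 1F ∷ 3F ∷ 0F ∷ 5F ∷ 2F ∷ []
spanning-forward 1F = 1F ∷ 4F ∷ 0F ∷ 6F ∷ 2F ∷ []
spanning-forward 2F = 1F ∷ 5F ∷ 0F ∷ 2F ∷ 3F ∷ []
spanning-forward 3F = 1F ∷ 2F ∷ 0F ∷ 3F ∷ 5F ∷ []
spanning-forward 4F = 1F ∷ 2F ∷ 0F ∷ 4F ∷ 5F ∷ []

spanning-backward : Fin 5 → Fin 5 → Fin 7
spanning-backward 0F = 1F ∷ 5F ∷ 2F ∷ 0F ∷ 3F ∷ []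
spanning-backward 1F = 1F ∷ 2F ∷ 3F ∷ 0F ∷ 5F ∷ []
spanning-backward 2F = 1F ∷ 2F ∷ 3F ∷ 0F ∷ 5F ∷ []
spanning-backward 3F = 1F ∷ 3F ∷ 4F ∷ 0F ∷ 6F ∷ []
spanning-backward 4F = 1F ∷ 4F ∷ 5F ∷ 0F ∷ 2F ∷ []

spanning-forward-correct : ∀ i →
  Embedding-via t₅ (extend₂ (twin i false) (twin (i +3) true) true) (spanning-forward i) ×
  spanning-forward i 0F ≡ 1F × spanning-forward i 2F ≡ 0F
spanning-forward-correct = from-yes (all? λ i →
  embedding? t₅ (extend₂ (twin i false) (twin (i +3) true) true) (spanning-forward i) ×-dec
  spanning-forward i 0F ≟ 1F ×-dec spanning-forward i 2F ≟ 0F)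

spanning-backward-correct : ∀ j →
  Embedding-via t₅ (extend₂ (twin (j +3) true) (twin j false) false) (spanning-backward j) ×
  spanning-backward j 0F ≡ 1F × spanning-backward j 3F ≡ 0F
spanning-backward-correct = from-yes (all? λ j →
  embedding? t₅ (extend₂ (twin (j +3) true) (twin j false) false) (spanning-backward j) ×-dec
  spanning-backward j 0F ≟ 1F ×-dec spanning-backward j 3F ≟ 0F)

exceptional-spans : ∀ {i β j γ e} → Exceptional i β j γ e →
  ∃ λ q → Σ (t₅ ↪ extend₂ (twin i β) (twin j γ) e) λ g → vertex g 0F ≡ 1F × vertex g q ≡ 0F
exceptional-spans {i} (inj₁ (refl , refl , refl , refl)) =
  let g-emb , at-0 , at-2 = spanning-forward-correct i in 2F , via g-emb , at-0 , at-2
exceptional-spans {j = j} (inj₂ (refl , refl , refl , refl)) =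
  let g-emb , at-0 , at-3 = spanning-backward-correct j in 3F , via g-emb , at-0 , at-3

-- Certificates: what the argument needs to know about F, checked by computation for U₅ and W₅

record Certificate (F : Arcs 5) : Set where
  field
    one-point     : ∀ p → (∃ λ s → IsTwin p s) ⊎ (∀ k → p k ≡ p 0F) ⊎ F ↪ extend t₅ p
    constant-twin : ∀ c j γ → F ↪ extend₂ (const c) (twin j γ) (not c)
    twin-pair     : ∀ {i j} β γ e → i ≢ j → e ≢ t₅ i j →
                    Exceptional i β j γ e ⊎ F ↪ extend₂ (twin i β) (twin j γ) e

∀-profile : {P : (Fin 5 → Bool) → Set} → (∀ {p q} → p ≗ q → P p → P q) →
            (∀ b₀ b₁ b₂ b₃ b₄ → P (b₀ ∷ b₁ ∷ b₂ ∷ b₃ ∷ b₄ ∷ [])) → ∀ p → P p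
∀-profile resp P-vec p =
  resp (λ { 0F → refl ; 1F → refl ; 2F → refl ; 3F → refl ; 4F → refl })
       (P-vec (p 0F) (p 1F) (p 2F) (p 3F) (p 4F))

module _ (F : Arcs 5) where

  OnePoint : (Fin 5 → Bool) → (Fin 5 → Fin 6) → Set
  OnePoint p g = (∃ λ s → IsTwin p s) ⊎ (∀ k → p k ≡ p 0F) ⊎ Embedding-via F (extend t₅ p) g

  one-point? : (table : Bool → Bool → Bool → Bool → Bool → Fin 5 → Fin 6) →
               Dec (∀ b₀ b₁ b₂ b₃ b₄ → OnePoint (b₀ ∷ b₁ ∷ b₂ ∷ b₃ ∷ b₄ ∷ []) (table b₀ b₁ b₂ b₃ b₄))
  one-point? table = ∀-Bool? λ b₀ → ∀-Bool? λ b₁ → ∀-Bool? λ b₂ → ∀-Bool? λ b₃ → ∀-Bool? λ b₄ →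
    let p = b₀ ∷ b₁ ∷ b₂ ∷ b₃ ∷ b₄ ∷ [] in
    any? (isTwin? p) ⊎-dec all? (λ k → p k ≟ᵇ p 0F) ⊎-dec embedding? F (extend t₅ p) (table b₀ b₁ b₂ b₃ b₄)

  constant-twin? : (table : Bool → Fin 5 → Bool → Fin 5 → Fin 7) →
                   Dec (∀ c j γ → Embedding-via F (extend₂ (const c) (twin j γ) (not c)) (table c j γ))
  constant-twin? table = ∀-Bool? λ c → all? λ j → ∀-Bool? λ γ →
    embedding? F (extend₂ (const c) (twin j γ) (not c)) (table c j γ)

  twin-pair? : (table : Fin 5 → Bool → Fin 5 → Bool → Bool → Fin 5 → Fin 7) →
               Dec (∀ i β j γ e → i ≢ j → e ≢ t₅ i j →
                    Exceptional i β j γ e ⊎ Embedding-via F (extend₂ (twin i β) (twin j γ) e) (table i β j γ e))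
  twin-pair? table = all? λ i → ∀-Bool? λ β → all? λ j → ∀-Bool? λ γ → ∀-Bool? λ e →
    ¬? (i ≟ j) →-dec ¬? (e ≟ᵇ t₅ i j) →-dec
    (exceptional? i β j γ e ⊎-dec embedding? F (extend₂ (twin i β) (twin j γ) e) (table i β j γ e))

  certify : ∀ one-point-table constant-twin-table twin-pair-table →
            True (one-point? one-point-table) → True (constant-twin? constant-twin-table) →
            True (twin-pair? twin-pair-table) → Certificate F
  certify _ _ _ one-point-ok constant-twin-ok twin-pair-ok = record
    { one-point     = ∀-profile respects λ b₀ b₁ b₂ b₃ b₄ →
        map₂ (map₂ via) (toWitness one-point-ok b₀ b₁ b₂ b₃ b₄)
    ; constant-twin = λ c j γ → via (toWitness constant-twin-ok c j γ)
    ; twin-pair     = λ {i} {j} β γ e i≢j e≢ → map₂ via (toWitness twin-pair-ok i β j γ e i≢j e≢)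
    }
    where
    respects : ∀ {p q} → p ≗ q →
               (∃ λ s → IsTwin p s) ⊎ (∀ k → p k ≡ p 0F) ⊎ F ↪ extend t₅ p →
               (∃ λ s → IsTwin q s) ⊎ (∀ k → q k ≡ q 0F) ⊎ F ↪ extend t₅ q
    respects p≗q (inj₁ (s , p-twin))    = inj₁ (s , λ k k≢s → trans (sym (p≗q k)) (p-twin k k≢s))
    respects p≗q (inj₂ (inj₁ p-const))  = inj₂ (inj₁ λ k → trans (sym (p≗q k)) (trans (p-const k) (p≗q 0F)))
    respects p≗q (inj₂ (inj₂ F↪))       = inj₂ (inj₂ (↪-resp (extend-cong t₅ p≗q) F↪))

-- Embeddings of F into the extensions; the inputs caught by the last clause of each table are
-- twins, constant, excluded by the hypotheses of twin-pair, or exceptional, and need no embedding.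

one-point-U : Bool → Bool → Bool → Bool → Bool → Fin 5 → Fin 6
one-point-U false false false false true  = 5F ∷ 1F ∷ 2F ∷ 0F ∷ 4F ∷ []
one-point-U false false false true  false = 4F ∷ 5F ∷ 1F ∷ 0F ∷ 3F ∷ []
one-point-U false false true  false false = 3F ∷ 4F ∷ 5F ∷ 0F ∷ 2F ∷ []
one-point-U false false true  false true  = 1F ∷ 0F ∷ 3F ∷ 5F ∷ 4F ∷ []
one-point-U false true  false false false = 2F ∷ 3F ∷ 4F ∷ 0F ∷ 1F ∷ []
one-point-U false true  false false true  = 2F ∷ 3F ∷ 4F ∷ 0F ∷ 1F ∷ []
one-point-U false true  false true  false = 4F ∷ 5F ∷ 1F ∷ 0F ∷ 3F ∷ []
one-point-U false true  false true  true  = 3F ∷ 0F ∷ 5F ∷ 2F ∷ 1F ∷ []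
one-point-U false true  true  false true  = 1F ∷ 0F ∷ 3F ∷ 5F ∷ 4F ∷ []
one-point-U false true  true  true  true  = 4F ∷ 5F ∷ 1F ∷ 2F ∷ 0F ∷ []
one-point-U true  false false false false = 1F ∷ 2F ∷ 3F ∷ 0F ∷ 5F ∷ []
one-point-U true  false false true  false = 1F ∷ 2F ∷ 3F ∷ 0F ∷ 5F ∷ []
one-point-U true  false true  false false = 3F ∷ 4F ∷ 5F ∷ 0F ∷ 2F ∷ []
one-point-U true  false true  false true  = 4F ∷ 0F ∷ 1F ∷ 3F ∷ 2F ∷ []
one-point-U true  false true  true  false = 2F ∷ 0F ∷ 4F ∷ 1F ∷ 5F ∷ []
one-point-U true  false true  true  true  = 5F ∷ 1F ∷ 2F ∷ 3F ∷ 0F ∷ []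
one-point-U true  true  false true  false = 1F ∷ 2F ∷ 3F ∷ 4F ∷ 0F ∷ []
one-point-U true  true  false true  true  = 1F ∷ 2F ∷ 3F ∷ 4F ∷ 0F ∷ []
one-point-U true  true  true  false true  = 2F ∷ 3F ∷ 4F ∷ 5F ∷ 0F ∷ []
one-point-U true  true  true  true  false = 3F ∷ 4F ∷ 5F ∷ 1F ∷ 0F ∷ []
one-point-U _     _     _     _     _     = const 0F

constant-twin-U : Bool → Fin 5 → Bool → Fin 5 → Fin 7
constant-twin-U true  0F false = 5F ∷ 2F ∷ 0F ∷ 3F ∷ 1F ∷ []
constant-twin-U true  0F true  = 5F ∷ 6F ∷ 0F ∷ 3F ∷ 1F ∷ []
constant-twin-U true  1F false = 2F ∷ 3F ∷ 0F ∷ 5F ∷ 1F ∷ []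
constant-twin-U true  1F true  = 6F ∷ 2F ∷ 0F ∷ 4F ∷ 1F ∷ []
constant-twin-U true  2F false = 2F ∷ 3F ∷ 0F ∷ 5F ∷ 1F ∷ []
constant-twin-U true  2F true  = 2F ∷ 3F ∷ 0F ∷ 5F ∷ 1F ∷ []
constant-twin-U true  3F false = 3F ∷ 4F ∷ 0F ∷ 6F ∷ 1F ∷ []
constant-twin-U true  3F true  = 3F ∷ 4F ∷ 0F ∷ 6F ∷ 1F ∷ []
constant-twin-U true  4F false = 4F ∷ 5F ∷ 0F ∷ 2F ∷ 1F ∷ []
constant-twin-U true  4F true  = 4F ∷ 5F ∷ 0F ∷ 2F ∷ 1F ∷ []
constant-twin-U false 0F false = 0F ∷ 3F ∷ 4F ∷ 1F ∷ 6F ∷ []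
constant-twin-U false 0F true  = 0F ∷ 2F ∷ 3F ∷ 1F ∷ 5F ∷ []
constant-twin-U false 1F false = 0F ∷ 4F ∷ 5F ∷ 1F ∷ 2F ∷ []
constant-twin-U false 1F true  = 0F ∷ 3F ∷ 4F ∷ 1F ∷ 6F ∷ []
constant-twin-U false 2F false = 0F ∷ 5F ∷ 6F ∷ 1F ∷ 3F ∷ []
constant-twin-U false 2F true  = 0F ∷ 4F ∷ 5F ∷ 1F ∷ 2F ∷ []
constant-twin-U false 3F false = 0F ∷ 6F ∷ 2F ∷ 1F ∷ 4F ∷ []
constant-twin-U false 3F true  = 0F ∷ 5F ∷ 2F ∷ 1F ∷ 3F ∷ []
constant-twin-U false 4F false = 0F ∷ 2F ∷ 3F ∷ 1F ∷ 5F ∷ []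
constant-twin-U false 4F true  = 0F ∷ 2F ∷ 3F ∷ 1F ∷ 5F ∷ []

twin-pair-U : Fin 5 → Bool → Fin 5 → Bool → Bool → Fin 5 → Fin 7
twin-pair-U 0F false 1F false false = 3F ∷ 0F ∷ 5F ∷ 1F ∷ 2F ∷ []
twin-pair-U 0F false 1F true  false = 4F ∷ 5F ∷ 6F ∷ 1F ∷ 0F ∷ []
twin-pair-U 0F false 2F false false = 3F ∷ 0F ∷ 5F ∷ 1F ∷ 2F ∷ []
twin-pair-U 0F false 2F true  false = 3F ∷ 0F ∷ 5F ∷ 1F ∷ 2F ∷ []
twin-pair-U 0F false 3F false true  = 2F ∷ 1F ∷ 3F ∷ 0F ∷ 5F ∷ []
twin-pair-U 0F false 4F false true  = 2F ∷ 1F ∷ 4F ∷ 0F ∷ 5F ∷ []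
twin-pair-U 0F false 4F true  true  = 2F ∷ 1F ∷ 4F ∷ 0F ∷ 5F ∷ []
twin-pair-U 0F true  1F false false = 3F ∷ 0F ∷ 5F ∷ 1F ∷ 6F ∷ []
twin-pair-U 0F true  1F true  false = 4F ∷ 5F ∷ 6F ∷ 1F ∷ 0F ∷ []
twin-pair-U 0F true  2F true  false = 5F ∷ 1F ∷ 2F ∷ 4F ∷ 0F ∷ []
twin-pair-U 0F true  3F false true  = 4F ∷ 0F ∷ 6F ∷ 2F ∷ 1F ∷ []
twin-pair-U 0F true  3F true  true  = 3F ∷ 0F ∷ 5F ∷ 2F ∷ 1F ∷ []
twin-pair-U 0F true  4F false true  = 3F ∷ 4F ∷ 5F ∷ 0F ∷ 1F ∷ []
twin-pair-U 0F true  4F true  true  = 3F ∷ 4F ∷ 5F ∷ 0F ∷ 1F ∷ []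
twin-pair-U 1F false 0F false true  = 3F ∷ 1F ∷ 5F ∷ 0F ∷ 2F ∷ []
twin-pair-U 1F false 0F true  true  = 3F ∷ 1F ∷ 5F ∷ 0F ∷ 6F ∷ []
twin-pair-U 1F false 2F false false = 4F ∷ 0F ∷ 6F ∷ 1F ∷ 2F ∷ []
twin-pair-U 1F false 2F true  false = 5F ∷ 6F ∷ 2F ∷ 1F ∷ 0F ∷ []
twin-pair-U 1F false 3F false false = 4F ∷ 0F ∷ 6F ∷ 1F ∷ 3F ∷ []
twin-pair-U 1F false 3F true  false = 2F ∷ 1F ∷ 4F ∷ 5F ∷ 0F ∷ []
twin-pair-U 1F false 4F false true  = 2F ∷ 1F ∷ 4F ∷ 0F ∷ 6F ∷ []
twin-pair-U 1F true  0F false true  = 4F ∷ 5F ∷ 6F ∷ 0F ∷ 1F ∷ []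
twin-pair-U 1F true  0F true  true  = 4F ∷ 5F ∷ 6F ∷ 0F ∷ 1F ∷ []
twin-pair-U 1F true  2F false false = 4F ∷ 0F ∷ 6F ∷ 1F ∷ 2F ∷ []
twin-pair-U 1F true  2F true  false = 5F ∷ 6F ∷ 2F ∷ 1F ∷ 0F ∷ []
twin-pair-U 1F true  3F true  false = 2F ∷ 1F ∷ 3F ∷ 5F ∷ 0F ∷ []
twin-pair-U 1F true  4F false true  = 2F ∷ 1F ∷ 4F ∷ 0F ∷ 6F ∷ []
twin-pair-U 1F true  4F true  true  = 4F ∷ 0F ∷ 6F ∷ 3F ∷ 1F ∷ []
twin-pair-U 2F false 0F false true  = 3F ∷ 1F ∷ 5F ∷ 0F ∷ 2F ∷ []
twin-pair-U 2F false 1F false true  = 4F ∷ 1F ∷ 6F ∷ 0F ∷ 2F ∷ []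
twin-pair-U 2F false 1F true  true  = 4F ∷ 1F ∷ 6F ∷ 0F ∷ 2F ∷ []
twin-pair-U 2F false 3F false false = 5F ∷ 0F ∷ 2F ∷ 1F ∷ 3F ∷ []
twin-pair-U 2F false 3F true  false = 6F ∷ 2F ∷ 3F ∷ 1F ∷ 0F ∷ []
twin-pair-U 2F false 4F false false = 5F ∷ 0F ∷ 2F ∷ 1F ∷ 4F ∷ []
twin-pair-U 2F false 4F true  false = 3F ∷ 1F ∷ 5F ∷ 6F ∷ 0F ∷ []
twin-pair-U 2F true  0F false true  = 3F ∷ 1F ∷ 5F ∷ 0F ∷ 2F ∷ []
twin-pair-U 2F true  0F true  true  = 5F ∷ 0F ∷ 2F ∷ 4F ∷ 1F ∷ []
twin-pair-U 2F true  1F false true  = 5F ∷ 6F ∷ 2F ∷ 0F ∷ 1F ∷ []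
twin-pair-U 2F true  1F true  true  = 5F ∷ 6F ∷ 2F ∷ 0F ∷ 1F ∷ []
twin-pair-U 2F true  3F false false = 2F ∷ 1F ∷ 4F ∷ 6F ∷ 0F ∷ []
twin-pair-U 2F true  3F true  false = 2F ∷ 1F ∷ 4F ∷ 5F ∷ 0F ∷ []
twin-pair-U 2F true  4F true  false = 2F ∷ 1F ∷ 4F ∷ 6F ∷ 0F ∷ []
twin-pair-U 3F false 0F false false = 2F ∷ 0F ∷ 3F ∷ 1F ∷ 5F ∷ []
twin-pair-U 3F false 0F true  false = 4F ∷ 1F ∷ 6F ∷ 2F ∷ 0F ∷ []
twin-pair-U 3F false 1F false true  = 4F ∷ 1F ∷ 6F ∷ 0F ∷ 3F ∷ []
twin-pair-U 3F false 2F false true  = 5F ∷ 1F ∷ 2F ∷ 0F ∷ 3F ∷ []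
twin-pair-U 3F false 2F true  true  = 2F ∷ 0F ∷ 4F ∷ 6F ∷ 1F ∷ []
twin-pair-U 3F false 4F false false = 2F ∷ 3F ∷ 4F ∷ 1F ∷ 0F ∷ []
twin-pair-U 3F false 4F true  false = 2F ∷ 3F ∷ 4F ∷ 1F ∷ 0F ∷ []
twin-pair-U 3F true  0F true  false = 3F ∷ 1F ∷ 5F ∷ 2F ∷ 0F ∷ []
twin-pair-U 3F true  1F false true  = 2F ∷ 0F ∷ 4F ∷ 5F ∷ 1F ∷ []
twin-pair-U 3F true  1F true  true  = 2F ∷ 0F ∷ 3F ∷ 5F ∷ 1F ∷ []
twin-pair-U 3F true  2F false true  = 6F ∷ 2F ∷ 3F ∷ 0F ∷ 1F ∷ []
twin-pair-U 3F true  2F true  true  = 2F ∷ 0F ∷ 4F ∷ 5F ∷ 1F ∷ []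
twin-pair-U 3F true  4F false false = 2F ∷ 3F ∷ 4F ∷ 1F ∷ 0F ∷ []
twin-pair-U 3F true  4F true  false = 2F ∷ 3F ∷ 4F ∷ 1F ∷ 0F ∷ []
twin-pair-U 4F false 0F false false = 2F ∷ 0F ∷ 4F ∷ 1F ∷ 5F ∷ []
twin-pair-U 4F false 0F true  false = 3F ∷ 4F ∷ 5F ∷ 1F ∷ 0F ∷ []
twin-pair-U 4F false 1F false false = 2F ∷ 0F ∷ 4F ∷ 1F ∷ 6F ∷ []
twin-pair-U 4F false 1F true  false = 2F ∷ 0F ∷ 4F ∷ 1F ∷ 6F ∷ []
twin-pair-U 4F false 2F false true  = 5F ∷ 1F ∷ 2F ∷ 0F ∷ 4F ∷ []
twin-pair-U 4F false 3F false true  = 2F ∷ 3F ∷ 4F ∷ 0F ∷ 1F ∷ []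
twin-pair-U 4F false 3F true  true  = 2F ∷ 3F ∷ 4F ∷ 0F ∷ 1F ∷ []
twin-pair-U 4F true  0F false false = 2F ∷ 0F ∷ 4F ∷ 1F ∷ 5F ∷ []
twin-pair-U 4F true  0F true  false = 3F ∷ 4F ∷ 5F ∷ 1F ∷ 0F ∷ []
twin-pair-U 4F true  1F true  false = 4F ∷ 1F ∷ 6F ∷ 3F ∷ 0F ∷ []
twin-pair-U 4F true  2F false true  = 3F ∷ 0F ∷ 5F ∷ 6F ∷ 1F ∷ []
twin-pair-U 4F true  2F true  true  = 2F ∷ 0F ∷ 4F ∷ 6F ∷ 1F ∷ []
twin-pair-U 4F true  3F false true  = 2F ∷ 3F ∷ 4F ∷ 0F ∷ 1F ∷ []
twin-pair-U 4F true  3F true  true  = 2F ∷ 3F ∷ 4F ∷ 0F ∷ 1F ∷ []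
twin-pair-U _  _     _  _     _     = const 0F

certificate-U : Certificate (arcU 2)
certificate-U = certify (arcU 2) one-point-U constant-twin-U twin-pair-U _ _ _

one-point-W : Bool → Bool → Bool → Bool → Bool → Fin 5 → Fin 6
one-point-W false false false false true  = 3F ∷ 4F ∷ 0F ∷ 5F ∷ 1F ∷ []
one-point-W false false false true  false = 2F ∷ 3F ∷ 0F ∷ 4F ∷ 5F ∷ []
one-point-W false false true  false false = 1F ∷ 2F ∷ 0F ∷ 3F ∷ 4F ∷ []
one-point-W false false true  false true  = 1F ∷ 2F ∷ 0F ∷ 3F ∷ 4F ∷ []
one-point-W false true  false false false = 5F ∷ 1F ∷ 0F ∷ 2F ∷ 3F ∷ []
one-point-W false true  false false true  = 3F ∷ 4F ∷ 0F ∷ 5F ∷ 1F ∷ []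
one-point-W false true  false true  false = 5F ∷ 1F ∷ 0F ∷ 2F ∷ 3F ∷ []
one-point-W false true  false true  true  = 3F ∷ 0F ∷ 4F ∷ 5F ∷ 2F ∷ []
one-point-W false true  true  false true  = 1F ∷ 0F ∷ 2F ∷ 3F ∷ 5F ∷ []
one-point-W false true  true  true  true  = 1F ∷ 0F ∷ 2F ∷ 3F ∷ 5F ∷ []
one-point-W true  false false false false = 4F ∷ 5F ∷ 0F ∷ 1F ∷ 2F ∷ []
one-point-W true  false false true  false = 2F ∷ 3F ∷ 0F ∷ 4F ∷ 5F ∷ []
one-point-W true  false true  false false = 4F ∷ 5F ∷ 0F ∷ 1F ∷ 2F ∷ []
one-point-W true  false true  false true  = 4F ∷ 0F ∷ 5F ∷ 1F ∷ 3F ∷ []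
one-point-W true  false true  true  false = 2F ∷ 0F ∷ 3F ∷ 4F ∷ 1F ∷ []
one-point-W true  false true  true  true  = 2F ∷ 0F ∷ 3F ∷ 4F ∷ 1F ∷ []
one-point-W true  true  false true  false = 5F ∷ 0F ∷ 1F ∷ 2F ∷ 4F ∷ []
one-point-W true  true  false true  true  = 3F ∷ 0F ∷ 4F ∷ 5F ∷ 2F ∷ []
one-point-W true  true  true  false true  = 4F ∷ 0F ∷ 5F ∷ 1F ∷ 3F ∷ []
one-point-W true  true  true  true  false = 5F ∷ 0F ∷ 1F ∷ 2F ∷ 4F ∷ []
one-point-W _     _     _     _     _     = const 0F

constant-twin-W : Bool → Fin 5 → Bool → Fin 5 → Fin 7
constant-twin-W true  0F false = 0F ∷ 1F ∷ 3F ∷ 4F ∷ 6F ∷ []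
constant-twin-W true  0F true  = 0F ∷ 1F ∷ 2F ∷ 3F ∷ 5F ∷ []
constant-twin-W true  1F false = 0F ∷ 1F ∷ 4F ∷ 5F ∷ 2F ∷ []
constant-twin-W true  1F true  = 0F ∷ 1F ∷ 3F ∷ 4F ∷ 6F ∷ []
constant-twin-W true  2F false = 0F ∷ 1F ∷ 5F ∷ 6F ∷ 3F ∷ []
constant-twin-W true  2F true  = 0F ∷ 1F ∷ 4F ∷ 5F ∷ 2F ∷ []
constant-twin-W true  3F false = 0F ∷ 1F ∷ 6F ∷ 2F ∷ 4F ∷ []
constant-twin-W true  3F true  = 0F ∷ 1F ∷ 5F ∷ 2F ∷ 3F ∷ []
constant-twin-W true  4F false = 0F ∷ 1F ∷ 2F ∷ 3F ∷ 5F ∷ []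
constant-twin-W true  4F true  = 0F ∷ 1F ∷ 2F ∷ 3F ∷ 5F ∷ []
constant-twin-W false 0F false = 5F ∷ 2F ∷ 1F ∷ 0F ∷ 3F ∷ []
constant-twin-W false 0F true  = 5F ∷ 6F ∷ 1F ∷ 0F ∷ 3F ∷ []
constant-twin-W false 1F false = 2F ∷ 3F ∷ 1F ∷ 0F ∷ 5F ∷ []
constant-twin-W false 1F true  = 6F ∷ 2F ∷ 1F ∷ 0F ∷ 4F ∷ []
constant-twin-W false 2F false = 2F ∷ 3F ∷ 1F ∷ 0F ∷ 5F ∷ []
constant-twin-W false 2F true  = 2F ∷ 3F ∷ 1F ∷ 0F ∷ 5F ∷ []
constant-twin-W false 3F false = 3F ∷ 4F ∷ 1F ∷ 0F ∷ 6F ∷ []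
constant-twin-W false 3F true  = 3F ∷ 4F ∷ 1F ∷ 0F ∷ 6F ∷ []
constant-twin-W false 4F false = 4F ∷ 5F ∷ 1F ∷ 0F ∷ 2F ∷ []
constant-twin-W false 4F true  = 4F ∷ 5F ∷ 1F ∷ 0F ∷ 2F ∷ []

twin-pair-W : Fin 5 → Bool → Fin 5 → Bool → Bool → Fin 5 → Fin 7
twin-pair-W 0F false 1F false false = 2F ∷ 0F ∷ 1F ∷ 4F ∷ 5F ∷ []
twin-pair-W 0F false 1F true  false = 2F ∷ 0F ∷ 1F ∷ 3F ∷ 5F ∷ []
twin-pair-W 0F false 2F false false = 6F ∷ 2F ∷ 1F ∷ 3F ∷ 0F ∷ []
twin-pair-W 0F false 2F true  false = 2F ∷ 0F ∷ 1F ∷ 4F ∷ 5F ∷ []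
twin-pair-W 0F false 3F false true  = 4F ∷ 5F ∷ 0F ∷ 6F ∷ 1F ∷ []
twin-pair-W 0F false 4F false true  = 2F ∷ 1F ∷ 3F ∷ 4F ∷ 0F ∷ []
twin-pair-W 0F false 4F true  true  = 2F ∷ 1F ∷ 3F ∷ 4F ∷ 0F ∷ []
twin-pair-W 0F true  1F false false = 3F ∷ 0F ∷ 4F ∷ 5F ∷ 1F ∷ []
twin-pair-W 0F true  1F true  false = 5F ∷ 6F ∷ 1F ∷ 2F ∷ 0F ∷ []
twin-pair-W 0F true  2F true  false = 3F ∷ 0F ∷ 4F ∷ 5F ∷ 1F ∷ []
twin-pair-W 0F true  3F false true  = 4F ∷ 5F ∷ 0F ∷ 6F ∷ 1F ∷ []
twin-pair-W 0F true  3F true  true  = 6F ∷ 1F ∷ 2F ∷ 3F ∷ 0F ∷ []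
twin-pair-W 0F true  4F false true  = 5F ∷ 1F ∷ 0F ∷ 2F ∷ 4F ∷ []
twin-pair-W 0F true  4F true  true  = 4F ∷ 5F ∷ 0F ∷ 6F ∷ 1F ∷ []
twin-pair-W 1F false 0F false true  = 2F ∷ 1F ∷ 0F ∷ 4F ∷ 5F ∷ []
twin-pair-W 1F false 0F true  true  = 3F ∷ 1F ∷ 4F ∷ 5F ∷ 0F ∷ []
twin-pair-W 1F false 2F false false = 3F ∷ 0F ∷ 1F ∷ 5F ∷ 6F ∷ []
twin-pair-W 1F false 2F true  false = 2F ∷ 0F ∷ 1F ∷ 4F ∷ 6F ∷ []
twin-pair-W 1F false 3F false false = 2F ∷ 3F ∷ 1F ∷ 4F ∷ 0F ∷ []
twin-pair-W 1F false 3F true  false = 2F ∷ 3F ∷ 1F ∷ 4F ∷ 0F ∷ []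
twin-pair-W 1F false 4F false true  = 5F ∷ 6F ∷ 0F ∷ 2F ∷ 1F ∷ []
twin-pair-W 1F true  0F false true  = 2F ∷ 1F ∷ 0F ∷ 3F ∷ 5F ∷ []
twin-pair-W 1F true  0F true  true  = 5F ∷ 6F ∷ 0F ∷ 2F ∷ 1F ∷ []
twin-pair-W 1F true  2F false false = 4F ∷ 0F ∷ 5F ∷ 6F ∷ 1F ∷ []
twin-pair-W 1F true  2F true  false = 2F ∷ 0F ∷ 1F ∷ 4F ∷ 6F ∷ []
twin-pair-W 1F true  3F true  false = 4F ∷ 0F ∷ 5F ∷ 6F ∷ 1F ∷ []
twin-pair-W 1F true  4F false true  = 2F ∷ 1F ∷ 3F ∷ 4F ∷ 0F ∷ []
twin-pair-W 1F true  4F true  true  = 2F ∷ 1F ∷ 3F ∷ 4F ∷ 0F ∷ []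
twin-pair-W 2F false 0F false true  = 6F ∷ 2F ∷ 0F ∷ 3F ∷ 1F ∷ []
twin-pair-W 2F false 1F false true  = 3F ∷ 1F ∷ 0F ∷ 5F ∷ 6F ∷ []
twin-pair-W 2F false 1F true  true  = 4F ∷ 1F ∷ 5F ∷ 6F ∷ 0F ∷ []
twin-pair-W 2F false 3F false false = 4F ∷ 0F ∷ 1F ∷ 6F ∷ 2F ∷ []
twin-pair-W 2F false 3F true  false = 3F ∷ 0F ∷ 1F ∷ 5F ∷ 2F ∷ []
twin-pair-W 2F false 4F false false = 3F ∷ 4F ∷ 1F ∷ 5F ∷ 0F ∷ []
twin-pair-W 2F false 4F true  false = 3F ∷ 4F ∷ 1F ∷ 5F ∷ 0F ∷ []
twin-pair-W 2F true  0F false true  = 2F ∷ 1F ∷ 0F ∷ 4F ∷ 5F ∷ []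
twin-pair-W 2F true  0F true  true  = 3F ∷ 1F ∷ 4F ∷ 5F ∷ 0F ∷ []
twin-pair-W 2F true  1F false true  = 2F ∷ 1F ∷ 0F ∷ 4F ∷ 6F ∷ []
twin-pair-W 2F true  1F true  true  = 2F ∷ 1F ∷ 0F ∷ 4F ∷ 6F ∷ []
twin-pair-W 2F true  3F false false = 2F ∷ 3F ∷ 1F ∷ 4F ∷ 0F ∷ []
twin-pair-W 2F true  3F true  false = 2F ∷ 3F ∷ 1F ∷ 4F ∷ 0F ∷ []
twin-pair-W 2F true  4F true  false = 5F ∷ 0F ∷ 6F ∷ 2F ∷ 1F ∷ []
twin-pair-W 3F false 0F false false = 4F ∷ 5F ∷ 1F ∷ 6F ∷ 0F ∷ []
twin-pair-W 3F false 0F true  false = 4F ∷ 5F ∷ 1F ∷ 6F ∷ 0F ∷ []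
twin-pair-W 3F false 1F false true  = 2F ∷ 3F ∷ 0F ∷ 4F ∷ 1F ∷ []
twin-pair-W 3F false 2F false true  = 4F ∷ 1F ∷ 0F ∷ 6F ∷ 2F ∷ []
twin-pair-W 3F false 2F true  true  = 2F ∷ 3F ∷ 0F ∷ 4F ∷ 1F ∷ []
twin-pair-W 3F false 4F false false = 5F ∷ 0F ∷ 1F ∷ 2F ∷ 3F ∷ []
twin-pair-W 3F false 4F true  false = 4F ∷ 0F ∷ 1F ∷ 6F ∷ 3F ∷ []
twin-pair-W 3F true  0F true  false = 6F ∷ 0F ∷ 2F ∷ 3F ∷ 1F ∷ []
twin-pair-W 3F true  1F false true  = 2F ∷ 3F ∷ 0F ∷ 4F ∷ 1F ∷ []
twin-pair-W 3F true  1F true  true  = 4F ∷ 1F ∷ 5F ∷ 6F ∷ 0F ∷ []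
twin-pair-W 3F true  2F false true  = 3F ∷ 1F ∷ 0F ∷ 5F ∷ 2F ∷ []
twin-pair-W 3F true  2F true  true  = 2F ∷ 3F ∷ 0F ∷ 4F ∷ 1F ∷ []
twin-pair-W 3F true  4F false false = 3F ∷ 4F ∷ 1F ∷ 5F ∷ 0F ∷ []
twin-pair-W 3F true  4F true  false = 3F ∷ 4F ∷ 1F ∷ 5F ∷ 0F ∷ []
twin-pair-W 4F false 0F false false = 2F ∷ 0F ∷ 3F ∷ 4F ∷ 1F ∷ []
twin-pair-W 4F false 0F true  false = 5F ∷ 0F ∷ 1F ∷ 2F ∷ 4F ∷ []
twin-pair-W 4F false 1F false false = 5F ∷ 6F ∷ 1F ∷ 2F ∷ 0F ∷ []
twin-pair-W 4F false 1F true  false = 2F ∷ 0F ∷ 3F ∷ 4F ∷ 1F ∷ []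
twin-pair-W 4F false 2F false true  = 3F ∷ 4F ∷ 0F ∷ 5F ∷ 1F ∷ []
twin-pair-W 4F false 3F false true  = 5F ∷ 1F ∷ 0F ∷ 2F ∷ 3F ∷ []
twin-pair-W 4F false 3F true  true  = 3F ∷ 4F ∷ 0F ∷ 5F ∷ 1F ∷ []
twin-pair-W 4F true  0F false false = 2F ∷ 0F ∷ 3F ∷ 4F ∷ 1F ∷ []
twin-pair-W 4F true  0F true  false = 4F ∷ 5F ∷ 1F ∷ 6F ∷ 0F ∷ []
twin-pair-W 4F true  1F true  false = 2F ∷ 0F ∷ 3F ∷ 4F ∷ 1F ∷ []
twin-pair-W 4F true  2F false true  = 3F ∷ 4F ∷ 0F ∷ 5F ∷ 1F ∷ []
twin-pair-W 4F true  2F true  true  = 5F ∷ 1F ∷ 6F ∷ 2F ∷ 0F ∷ []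
twin-pair-W 4F true  3F false true  = 4F ∷ 1F ∷ 0F ∷ 6F ∷ 3F ∷ []
twin-pair-W 4F true  3F true  true  = 3F ∷ 4F ∷ 0F ∷ 5F ∷ 1F ∷ []
twin-pair-W _  _     _  _     _     = const 0F

certificate-W : Certificate (arcW 2)
certificate-W = certify (arcW 2) one-point-W constant-twin-W twin-pair-W _ _ _
-- Diamonds

UniformTriangle : Arcs n → Fin n → Set
UniformTriangle a x = ∃ λ c₁ → ∃ λ c₂ → ∃ λ c₃ →
  (a c₁ c₂ ≡ true × a c₂ c₃ ≡ true × a c₃ c₁ ≡ true) × (a x c₂ ≡ a x c₁ × a x c₃ ≡ a x c₁)

UniformTriangle-↪ : {a : Arcs m} {b : Arcs n} (X : a ↪ b) {x : Fin m} →
                    UniformTriangle a x → UniformTriangle b (vertex X x)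
UniformTriangle-↪ {a = a} {b} X {x} (c₁ , c₂ , c₃ , (c₁→c₂ , c₂→c₃ , c₃→c₁) , (x₂ , x₃)) =
  v c₁ , v c₂ , v c₃ ,
  (trans (preserves X c₁ c₂) c₁→c₂ , trans (preserves X c₂ c₃) c₂→c₃ , trans (preserves X c₃ c₁) c₃→c₁) ,
  (same x₂ , same x₃)
  where
  v = vertex X
  same : ∀ {c} → a x c ≡ a x c₁ → b (v x) (v c) ≡ b (v x) (v c₁)
  same {c} xc = trans (preserves X x c) (trans xc (sym (preserves X x c₁)))

IsIntervalᵃ : Arcs n → Subset n → Set
IsIntervalᵃ a I = ∀ x → x ∉ I → (∀ y → y ∈ I → a x y ≡ true) ⊎ (∀ y → y ∈ I → a y x ≡ true)

interval? : (a : Arcs n) (I : Subset n) → Dec (IsIntervalᵃ a I)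
interval? a I = all? λ x → ¬? (x ∈? I) →-dec
  ((all? λ y → y ∈? I →-dec a x y ≟ᵇ true) ⊎-dec (all? λ y → y ∈? I →-dec a y x ≟ᵇ true))

IsIntervalᵃ-resp : {a b : Arcs n} {I : Subset n} → (∀ i j → a i j ≡ b i j) → IsIntervalᵃ a I → IsIntervalᵃ b I
IsIntervalᵃ-resp a≗b I-int x x∉I with I-int x x∉I
... | inj₁ x→I = inj₁ λ y y∈I → trans (sym (a≗b x y)) (x→I y y∈I)
... | inj₂ I→x = inj₂ λ y y∈I → trans (sym (a≗b y x)) (I→x y y∈I)

∁⁅⁆-injective : {x y : Fin n} → ∁ ⁅ x ⁆ ≡ ∁ ⁅ y ⁆ → x ≡ y
∁⁅⁆-injective {x = x} {y} eq =
  x∈⁅y⁆⇒x≡y y (x∉∁p⇒x∈p λ x∈∁⁅y⁆ → x∈p⇒x∉∁p (x∈⁅x⁆ x) (subst (x ∈_) (sym eq) x∈∁⁅y⁆))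

∣I∣≡3⇒co-singleton : ∀ (I : Subset 4) → ∣ I ∣ ≡ 3 → ∃ λ x → I ≡ ∁ ⁅ x ⁆
∣I∣≡3⇒co-singleton I = decidable-stable (co-singleton? I) λ ¬I → from-no (anySubset? (¬? ∘ co-singleton?)) (I , ¬I)
  where
  co-singleton? : ∀ (I : Subset 4) → Dec (∣ I ∣ ≡ 3 → ∃ λ x → I ≡ ∁ ⁅ x ⁆)
  co-singleton? I = ∣ I ∣ ≟ℕ 3 →-dec any? λ x → ≡-dec _≟ᵇ_ I (∁ ⁅ x ⁆)

∣∁⁅x⁆∣≡3 : ∀ (x : Fin 4) → ∣ ∁ ⁅ x ⁆ ∣ ≡ 3
∣∁⁅x⁆∣≡3 0F = refl
∣∁⁅x⁆∣≡3 1F = refl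
∣∁⁅x⁆∣≡3 2F = refl
∣∁⁅x⁆∣≡3 3F = refl

tournament₄ : Bool → Bool → Bool → Bool → Bool → Bool → Arcs 4
tournament₄ a b c d e f 0F 0F = false
tournament₄ a b c d e f 0F 1F = a
tournament₄ a b c d e f 0F 2F = b
tournament₄ a b c d e f 0F 3F = c
tournament₄ a b c d e f 1F 0F = not a
tournament₄ a b c d e f 1F 1F = false
tournament₄ a b c d e f 1F 2F = d
tournament₄ a b c d e f 1F 3F = e
tournament₄ a b c d e f 2F 0F = not b
tournament₄ a b c d e f 2F 1F = not d
tournament₄ a b c d e f 2F 2F = false
tournament₄ a b c d e f 2F 3F = f
tournament₄ a b c d e f 3F 0F = not c
tournament₄ a b c d e f 3F 1F = not e
tournament₄ a b c d e f 3F 2F = not f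
tournament₄ a b c d e f 3F 3F = false

module _ (D : Tournament 4) where

  private
    d = arc D

  tournament₄-arc : ∀ i j → d i j ≡ tournament₄ (d 0F 1F) (d 0F 2F) (d 0F 3F) (d 1F 2F) (d 1F 3F) (d 2F 3F) i j
  tournament₄-arc 0F 0F = irrefl D 0F
  tournament₄-arc 0F 1F = refl
  tournament₄-arc 0F 2F = refl
  tournament₄-arc 0F 3F = refl
  tournament₄-arc 1F 0F = total D 0F 1F λ ()
  tournament₄-arc 1F 1F = irrefl D 1F
  tournament₄-arc 1F 2F = refl
  tournament₄-arc 1F 3F = refl
  tournament₄-arc 2F 0F = total D 0F 2F λ ()
  tournament₄-arc 2F 1F = total D 1F 2F λ ()
  tournament₄-arc 2F 2F = irrefl D 2F
  tournament₄-arc 2F 3F = refl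
  tournament₄-arc 3F 0F = total D 0F 3F λ ()
  tournament₄-arc 3F 1F = total D 1F 3F λ ()
  tournament₄-arc 3F 2F = total D 2F 3F λ ()
  tournament₄-arc 3F 3F = irrefl D 3F

unique-co-singleton⇒triangle : ∀ b₀₁ b₀₂ b₀₃ b₁₂ b₁₃ b₂₃ x → let a = tournament₄ b₀₁ b₀₂ b₀₃ b₁₂ b₁₃ b₂₃ in
  IsIntervalᵃ a (∁ ⁅ x ⁆) → (∀ z → IsIntervalᵃ a (∁ ⁅ z ⁆) → z ≡ x) → UniformTriangle a x
unique-co-singleton⇒triangle = from-yes
  (∀-Bool? λ b₀₁ → ∀-Bool? λ b₀₂ → ∀-Bool? λ b₀₃ → ∀-Bool? λ b₁₂ → ∀-Bool? λ b₁₃ → ∀-Bool? λ b₂₃ → all? λ x →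
    let a = tournament₄ b₀₁ b₀₂ b₀₃ b₁₂ b₁₃ b₂₃ in
    interval? a (∁ ⁅ x ⁆) →-dec (all? λ z → interval? a (∁ ⁅ z ⁆) →-dec z ≟ x) →-dec
    any? λ c₁ → any? λ c₂ → any? λ c₃ →
      (a c₁ c₂ ≟ᵇ true ×-dec a c₂ c₃ ≟ᵇ true ×-dec a c₃ c₁ ≟ᵇ true) ×-dec (a x c₂ ≟ᵇ a x c₁ ×-dec a x c₃ ≟ᵇ a x c₁))

diamond-triangle : (D : Tournament 4) → IsDiamond D → ∃ (UniformTriangle (arc D))
diamond-triangle D (I , I-interval , ∣I∣≡3 , I-unique) with ∣I∣≡3⇒co-singleton I ∣I∣≡3
... | x , refl = x , UniformTriangle-↪ (↪-resp a≗d ↪-refl)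
  (unique-co-singleton⇒triangle (d 0F 1F) (d 0F 2F) (d 0F 3F) (d 1F 2F) (d 1F 3F) (d 2F 3F) x
    (IsIntervalᵃ-resp d≗a I-interval)
    (λ z z-int → ∁⁅⁆-injective (I-unique (∁ ⁅ z ⁆) (IsIntervalᵃ-resp a≗d z-int) (∣∁⁅x⁆∣≡3 z))))
  where
  d = arc D
  d≗a = tournament₄-arc D
  a≗d : ∀ i j → tournament₄ (d 0F 1F) (d 0F 2F) (d 0F 3F) (d 1F 2F) (d 1F 3F) (d 2F 3F) i j ≡ d i j
  a≗d i j = sym (d≗a i j)

-- Around a copy of T₅ in an indecomposable tournament without a copy of F

module Argument (T : Tournament n) (indecomposable : Indecomposable T)
                {F : Arcs 5} (certificate : Certificate F) (no-F : ¬ F ↪ arc T) where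

  open Certificate certificate

  Copy : Set
  Copy = t₅ ↪ arc T

  profile : Copy → Fin n → Fin 5 → Bool
  profile X u k = arc T u (vertex X k)

  Twin : Copy → Fin 5 → Fin n → Set
  Twin X s u = IsTwin (profile X u) s

  twin? : ∀ X s → Decidable (Twin X s)
  twin? X s u = isTwin? (profile X u) s

  Twinned : Copy → Fin n → Set
  Twinned X u = ∃ λ s → Twin X s u

  twinned? : ∀ X → Decidable (Twinned X)
  twinned? X u = any? λ s → twin? X s u

  New : Copy → Fin n → Set
  New X u = ∀ k → vertex X k ≢ u

  new? : ∀ X u → ∃ (λ k → vertex X k ≡ u) ⊎ New X u
  new? X u with any? (λ k → vertex X k ≟ u)
  ... | yes on-X  = inj₁ on-X
  ... | no  off-X = inj₂ λ k x≡u → off-X (k , x≡u)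

  vertex-twin : ∀ X k → Twin X k (vertex X k)
  vertex-twin X k l _ = preserves X k l

  vertex-twin-unique : ∀ X {s k} → Twin X s (vertex X k) → k ≡ s
  vertex-twin-unique X {s} {k} x-twin with k ≟ s
  ... | yes k≡s = k≡s
  ... | no  k≢s = ⊥-elim (t₅-twin-free k s k≢s λ l l≢k l≢s → trans (sym (preserves X k l)) (x-twin l l≢s))

  arc-to-twin : ∀ X {s k y} → Twin X s y → k ≢ s → arc T (vertex X k) y ≡ t₅ k s
  arc-to-twin X {s} {k} {y} y-twin k≢s =
    trans (total T y (vertex X k) y≢x) (trans (cong not (y-twin k k≢s)) (sym (total T₅ s k (k≢s ∘ sym))))
    where
    y≢x : y ≢ vertex X k
    y≢x refl = k≢s (vertex-twin-unique X y-twin)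

  swap : (X : Copy) {s : Fin 5} {u : Fin n} → Twin X s u → Copy
  swap X {s} u-twin =
    replace T T₅ X u-twin λ k k≢s x≡u → k≢s (vertex-twin-unique X (subst (Twin X s) (sym x≡u) u-twin))

  swap-at : ∀ X {s u} (u-twin : Twin X s u) → vertex (swap X u-twin) s ≡ u
  swap-at X {s} _ = updateAt-updates s (vertex X)

  swap-off : ∀ X {s u} (u-twin : Twin X s u) {k} → k ≢ s → vertex (swap X u-twin) k ≡ vertex X k
  swap-off X {s} _ k≢s = updateAt-minimal _ s (vertex X) k≢s

  Twin-swap : ∀ X {s u v} (u-twin : Twin X s u) → Twin X s v → Twin (swap X u-twin) s v
  Twin-swap X u-twin v-twin k k≢s = trans (cong (arc T _) (swap-off X u-twin k≢s)) (v-twin k k≢s)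

  one-vertex-↪ : ∀ X {u} → New X u → extend t₅ (profile X u) ↪ arc T
  one-vertex-↪ X {u} u-new = extend-↪ T X u u-new λ _ → refl

  two-vertex-↪ : ∀ X {y z p q} → New X y → New X z → y ≢ z →
                 profile X y ≗ p → profile X z ≗ q → extend₂ p q (arc T y z) ↪ arc T
  two-vertex-↪ X {y} {z} {p} {q} y-new z-new y≢z y-p z-q =
    extend-↪ T (extend-↪ T X y y-new y-p) z z-new′ z-arcs
    where
    z-new′ : ∀ k → (y ∷ vertex X) k ≢ z
    z-new′ zero    = y≢z
    z-new′ (suc k) = z-new k
    z-arcs : ∀ k → arc T z ((y ∷ vertex X) k) ≡ (not (arc T y z) ∷ q) k
    z-arcs zero    = total T y z y≢z
    z-arcs (suc k) = z-q k

  twin-pair-↪ : ∀ X {i j y z} → Twin X i y → Twin X j z → New X y → New X z → y ≢ z →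
                extend₂ (twin i (profile X y i)) (twin j (profile X z j)) (arc T y z) ↪ arc T
  twin-pair-↪ X y-twin z-twin y-new z-new y≢z =
    two-vertex-↪ X y-new z-new y≢z (IsTwin⇒twin y-twin) (IsTwin⇒twin z-twin)

  exceptional : ∀ X {i j y z} → i ≢ j → (y-twin : Twin X i y) (z-twin : Twin X j z) →
                New X y → New X z → y ≢ z → arc T y z ≢ t₅ i j →
                Exceptional i (profile X y i) j (profile X z j) (arc T y z)
  exceptional X i≢j y-twin z-twin y-new z-new y≢z y↛z with twin-pair _ _ _ i≢j y↛z
  ... | inj₁ exc = exc
  ... | inj₂ F↪  = ⊥-elim (no-F (↪-trans F↪ (twin-pair-↪ X y-twin z-twin y-new z-new y≢z)))

  constant-profile-uniform : ∀ X {z c} → New X z → (∀ k → profile X z k ≡ c) →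
                             ∀ {j y} → Twin X j y → z ≢ y → arc T z y ≡ c
  constant-profile-uniform X {z} {c} z-new z-const {j} {y} y-twin z≢y with new? X y
  ... | inj₁ (k , refl) = z-const k
  ... | inj₂ y-new with arc T z y ≟ᵇ c
  ...   | yes z→y = z→y
  ...   | no  z↛y = ⊥-elim (no-F (↪-trans (constant-twin c j (profile X y j))
                      (subst (λ e → extend₂ (const c) (twin j (profile X y j)) e ↪ arc T) (¬-not z↛y)
                        (two-vertex-↪ X z-new y-new z≢y z-const (IsTwin⇒twin y-twin)))))

  twinned-interval : ∀ X → IsInterval T ⟦ twinned? X ⟧
  twinned-interval X z z∉Q = from-one-point (one-point (profile X z))
    where
    z-new : New X z
    z-new k refl = z∉Q (∈⟦⟧⁺ (twinned? X) (k , vertex-twin X k))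
    z≢ : ∀ {y} → y ∈ ⟦ twinned? X ⟧ → z ≢ y
    z≢ y∈Q refl = z∉Q y∈Q
    from-one-point : Twinned X z ⊎ (∀ k → profile X z k ≡ profile X z 0F) ⊎ F ↪ extend t₅ (profile X z) →
                     (∀ y → y ∈ ⟦ twinned? X ⟧ → arc T z y ≡ true) ⊎ (∀ y → y ∈ ⟦ twinned? X ⟧ → arc T y z ≡ true)
    from-one-point (inj₁ z-twinned)      = ⊥-elim (z∉Q (∈⟦⟧⁺ (twinned? X) z-twinned))
    from-one-point (inj₂ (inj₁ z-const)) = one-sided T z≢ λ y∈Q →
      constant-profile-uniform X z-new z-const (proj₂ (∈⟦⟧⁻ (twinned? X) y∈Q)) (z≢ y∈Q)
    from-one-point (inj₂ (inj₂ F↪))      = ⊥-elim (no-F (↪-trans F↪ (one-vertex-↪ X z-new)))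

  constant-profile-absurd : ∀ X {u} → (∀ k → profile X u k ≡ profile X u 0F) → Empty
  constant-profile-absurd X {u} u-const =
    ¬IsTrivial (∈⟦⟧⁺ (twinned? X) (0F , vertex-twin X 0F)) (∈⟦⟧⁺ (twinned? X) (1F , vertex-twin X 1F))
               (λ eq → 0≢1 (injective X eq)) u∉Q (indecomposable _ (twinned-interval X))
    where
    0≢1 : 0F ≢ 1F
    0≢1 ()
    u∉Q : u ∉ ⟦ twinned? X ⟧
    u∉Q u∈Q with ∈⟦⟧⁻ (twinned? X) u∈Q
    ... | s , u-twin = constant-not-twin (profile X u 0F) s λ k k≢s → trans (sym (u-const k)) (u-twin k k≢s)

  all-twinned : ∀ X u → Twinned X u
  all-twinned X u with new? X u
  ... | inj₁ (k , refl) = k , vertex-twin X k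
  ... | inj₂ u-new with one-point (profile X u)
  ...   | inj₁ u-twinned      = u-twinned
  ...   | inj₂ (inj₁ u-const) = ⊥-elim (constant-profile-absurd X u-const)
  ...   | inj₂ (inj₂ F↪)      = ⊥-elim (no-F (↪-trans F↪ (one-vertex-↪ X u-new)))

  record Separator (X : Copy) (s : Fin 5) : Set where
    field
      {w y₁ y₂} : Fin n
      w-out     : ¬ Twin X s w
      y₁-in     : Twin X s y₁
      y₂-in     : Twin X s y₂
      w↛y₁      : arc T w y₁ ≡ false
      y₂↛w      : arc T y₂ w ≡ false

  other : (s : Fin 5) → ∃ λ t → t ≢ s
  other zero    = 1F , λ ()
  other (suc _) = 0F , λ ()

  -- A twin class with two members is not an interval.
  separator : ∀ X s {a b} → Twin X s a → Twin X s b → a ≢ b → ¬ ¬ Separator X s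
  separator X s a-in b-in a≢b no-separator =
    ¬IsTrivial (∈⟦⟧⁺ (twin? X s) a-in) (∈⟦⟧⁺ (twin? X s) b-in) a≢b x∉K (indecomposable K K-interval)
    where
    K : Subset n
    K = ⟦ twin? X s ⟧
    x∉K : vertex X (proj₁ (other s)) ∉ K
    x∉K x∈K = proj₂ (other s) (vertex-twin-unique X (∈⟦⟧⁻ (twin? X s) x∈K))
    K-interval : IsInterval T K
    K-interval w w∉K with all? (λ y → y ∈? K →-dec arc T w y ≟ᵇ true)
                        | all? (λ y → y ∈? K →-dec arc T y w ≟ᵇ true)
    ... | yes w→K | _       = inj₁ w→K
    ... | no _    | yes K→w = inj₂ K→w
    ... | no w↛K  | no K↛w  with counterexample (_∈? K) (λ y → arc T w y ≟ᵇ true) w↛K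
                                | counterexample (_∈? K) (λ y → arc T y w ≟ᵇ true) K↛w
    ...   | y₁ , y₁∈K , w↛y₁ | y₂ , y₂∈K , y₂↛w = ⊥-elim (no-separator record
      { w-out = w∉K ∘ ∈⟦⟧⁺ (twin? X s)
      ; y₁-in = ∈⟦⟧⁻ (twin? X s) y₁∈K ; y₂-in = ∈⟦⟧⁻ (twin? X s) y₂∈K
      ; w↛y₁  = ¬-not w↛y₁ ; y₂↛w = ¬-not y₂↛w })

  record Shrinker (X : Copy) (s : Fin 5) : Set where
    field
      {t}     : Fin 5
      {w y}   : Fin n
      s≢t     : s ≢ t
      w-twin  : Twin X t w
      w-new   : New X w
      w-out   : ¬ Twin X s w
      y-in    : Twin X s y
      y↛w     : arc T y w ≢ t₅ s t

  separator⇒shrinker : ∀ {X s} → Separator X s → Shrinker X s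
  separator⇒shrinker {X} {s} sep with all-twinned X (Separator.w sep)
  ... | t , w-twin = choose (t₅ s t) refl
    where
    open Separator sep
    s≢t : s ≢ t
    s≢t refl = w-out w-twin
    w-new : New X w
    w-new k refl with vertex-twin-unique X w-twin
    ... | refl with () ← trans (sym (arc-converse T (λ { refl → w-out y₂-in }) y₂↛w))
                               (trans (arc-to-twin X y₂-in (s≢t ∘ sym))
                                      (trans (sym (arc-to-twin X y₁-in (s≢t ∘ sym))) w↛y₁))
    choose : ∀ b → t₅ s t ≡ b → Shrinker X s
    choose true  s→t = record { s≢t = s≢t ; w-twin = w-twin ; w-new = w-new ; w-out = w-out ; y-in = y₂-in
                              ; y↛w = λ y₂→w → case trans (sym s→t) (trans (sym y₂→w) y₂↛w) of λ () }
    choose false t→s = record { s≢t = s≢t ; w-twin = w-twin ; w-new = w-new ; w-out = w-out ; y-in = y₁-in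
                              ; y↛w = λ y₁→w → case trans (sym (arc-converse T (λ { refl → w-out y₁-in }) w↛y₁))
                                                          (trans y₁→w t→s) of λ () }

  module Shrinking {X s} (sh : Shrinker X s) where

    open Shrinker sh

    X′ : Copy
    X′ = swap X w-twin

    private
      off-t : ∀ {k} → k ≢ t → vertex X′ k ≡ vertex X k
      off-t = swap-off X w-twin
      at-t : vertex X′ t ≡ w
      at-t = swap-at X w-twin
      t≢s : t ≢ s
      t≢s = s≢t ∘ sym

    leaves : ¬ Twin X′ s y
    leaves y-in′ = y↛w (trans (cong (arc T y) (sym at-t)) (y-in′ t t≢s))

    y-exceptional : Exceptional s (profile X y s) t (profile X w t) (arc T y w)
    y-exceptional = exceptional X s≢t y-in w-twin y-new w-new (λ { refl → w-out y-in }) y↛w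
      where
      y-new : New X y
      y-new k refl with vertex-twin-unique X y-in
      ... | refl = y↛w (arc-to-twin X w-twin s≢t)

    -- A twin of r ≢ s entering the class of s is joined to w like a twin of s: as T₅ is twin-free,
    -- r ≢ t and its pair with w is exceptional, like the pair y, w; so r ≡ s after all.
    moved-absurd : ∀ {u r} → Twin X′ s u → r ≢ s → Twin X r u → Empty
    moved-absurd {u} {r} u-in′ r≢s u-twin with r ≟ t
    ... | yes refl = t₅-twin-free s r s≢t λ k k≢s k≢r → trans (sym (agrees k≢s k≢r)) (u-twin k k≢r)
      where
      agrees : ∀ {k} → k ≢ s → k ≢ t → profile X u k ≡ t₅ s k
      agrees k≢s k≢t = trans (cong (arc T u) (sym (off-t k≢t))) (u-in′ _ k≢s)
    ... | no r≢t with arc T u w ≟ᵇ t₅ r t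
    ...   | yes u→w = t₅-twin-free s r (r≢s ∘ sym) agree-off
      where
      agree-off : ∀ k → k ≢ s → k ≢ r → t₅ s k ≡ t₅ r k
      agree-off k k≢s k≢r with k ≟ t
      ... | yes refl = trans (sym (trans (cong (arc T u) (sym at-t)) (u-in′ t t≢s))) u→w
      ... | no  k≢t  = trans (sym (trans (cong (arc T u) (sym (off-t k≢t))) (u-in′ k k≢s))) (u-twin k k≢r)
    ...   | no  u↛w = r≢s (exceptional-unique (exceptional X r≢t u-twin w-twin u-new w-new u≢w u↛w) y-exceptional)
      where
      u-new : New X u
      u-new k refl with vertex-twin-unique X u-twin
      ... | refl = r≢s (vertex-twin-unique X′ (subst (Twin X′ s) (sym (off-t r≢t)) u-in′))
      u≢w : u ≢ w
      u≢w refl = t≢s (vertex-twin-unique X′ (subst (Twin X′ s) (sym at-t) u-in′))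

    stays : ∀ {u} → Twin X′ s u → Twin X s u
    stays {u} u-in′ with all-twinned X u
    ... | r , u-twin with r ≟ s
    ...   | yes refl = u-twin
    ...   | no  r≢s  = ⊥-elim (moved-absurd u-in′ r≢s u-twin)

    shrink : ⟦ twin? X′ s ⟧ ⊂ ⟦ twin? X s ⟧
    shrink = (λ u∈ → ∈⟦⟧⁺ (twin? X s) (stays (∈⟦⟧⁻ (twin? X′ s) u∈))) ,
             y , ∈⟦⟧⁺ (twin? X s) y-in , leaves ∘ ∈⟦⟧⁻ (twin? X′ s)

  module Apex (d : Fin n) (β : Bool) where

    Triangle : Fin n → Fin n → Fin n → Set
    Triangle a b c = (arc T a b ≡ true × arc T b c ≡ true × arc T c a ≡ true) ×
                     (arc T d a ≡ β × arc T d b ≡ β × arc T d c ≡ β)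

    rotate : ∀ {a b c} → Triangle a b c → Triangle b c a
    rotate ((a→b , b→c , c→a) , (da , db , dc)) = (b→c , c→a , a→b) , (db , dc , da)

    three-on-copy-absurd : ∀ X {p q r a b c} → vertex X p ≡ a → vertex X q ≡ b → vertex X r ≡ c →
                           Triangle a b c → Empty
    three-on-copy-absurd X {p} {q} {r} refl refl refl ((a→b , b→c , c→a) , (da , db , dc)) with all-twinned X d
    ... | k , d-twin = twin-not-constant-on-triangle k (profile X d k) p q r β
      ( trans (sym (preserves X p q)) a→b , trans (sym (preserves X q r)) b→c , trans (sym (preserves X r p)) c→a
      , trans (sym (IsTwin⇒twin d-twin p)) da , trans (sym (IsTwin⇒twin d-twin q)) db
      , trans (sym (IsTwin⇒twin d-twin r)) dc )

    -- c is a twin of neither p nor q, as it is joined to a and b unlike the vertices p and q.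
    two-on-copy-absurd : ∀ X {p q a b c} → vertex X p ≡ a → vertex X q ≡ b → Triangle a b c → Empty
    two-on-copy-absurd X {p} {q} {c = c} refl refl tri@((a→b , b→c , c→a) , _) =
      third (all-twinned X c) (λ { refl → arc⇒≢ T a→b refl })
      where
      third : Twinned X c → p ≢ q → Empty
      third (r , c-twin) p≢q with r ≟ p | r ≟ q
      ... | yes refl | _ with () ← trans (sym (arc-asym T b→c))
                                         (trans (c-twin q (p≢q ∘ sym)) (trans (sym (preserves X p q)) a→b))
      ... | no _ | yes refl with () ← trans (sym c→a)
                                            (trans (c-twin p p≢q) (trans (sym (preserves X q p)) (arc-asym T a→b)))
      ... | no r≢p | no r≢q = three-on-copy-absurd (swap X c-twin) (swap-off X c-twin (r≢p ∘ sym))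
                                (swap-off X c-twin (r≢q ∘ sym)) (swap-at X c-twin) tri

    -- a and b are moved onto one copy by swaps or, for an exceptional pair, by exceptional-spans.
    distinct-classes-absurd : ∀ X {i j a b c} → i ≢ j → Twin X i a → Twin X j b → Triangle a b c → Empty
    distinct-classes-absurd X {i} {j} {a} {b} i≢j a-in b-in tri@((a→b , _) , _) with new? X a | new? X b
    ... | inj₁ (k , x≡a) | _ with vertex-twin-unique X (subst (Twin X i) (sym x≡a) a-in)
    ...   | refl = two-on-copy-absurd (swap X b-in) (trans (swap-off X b-in i≢j) x≡a) (swap-at X b-in) tri
    distinct-classes-absurd X {i} {j} {a} {b} i≢j a-in b-in tri | inj₂ _ | inj₁ (k , x≡b)
      with vertex-twin-unique X (subst (Twin X j) (sym x≡b) b-in)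
    ...   | refl = two-on-copy-absurd (swap X a-in) (swap-at X a-in) (trans (swap-off X a-in (i≢j ∘ sym)) x≡b) tri
    distinct-classes-absurd X {i} {j} {a} {b} i≢j a-in b-in tri@((a→b , _) , _) | inj₂ a-new | inj₂ b-new
      with arc T a b ≟ᵇ t₅ i j
    ... | yes a→b′ = two-on-copy-absurd X₂ (trans (swap-off X₁ b-in₁ i≢j) (swap-at X a-in)) (swap-at X₁ b-in₁) tri
      where
      X₁ : Copy
      X₁ = swap X a-in
      b-in₁ : Twin X₁ j b
      b-in₁ k k≢j with k ≟ i
      ... | yes refl = trans (cong (arc T b) (swap-at X a-in))
                         (trans (total T a b (arc⇒≢ T a→b)) (trans (cong not a→b′) (sym (total T₅ k j i≢j))))
      ... | no  k≢i  = trans (cong (arc T b) (swap-off X a-in k≢i)) (b-in k k≢j)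
      X₂ : Copy
      X₂ = swap X₁ b-in₁
    ... | no a↛b with exceptional-spans (exceptional X i≢j a-in b-in a-new b-new (arc⇒≢ T a→b) a↛b)
    ...   | q , g , g-0 , g-q = two-on-copy-absurd (↪-trans g P) (cong (vertex P) g-0) (cong (vertex P) g-q) tri
      where
      P = twin-pair-↪ X a-in b-in a-new b-new (arc⇒≢ T a→b)

    one-class-absurd : ∀ X s {c₁ c₂ c₃} → vertex X s ≡ c₁ → Twin X s c₂ → Twin X s c₃ → Triangle c₁ c₂ c₃ →
                       Acc _<_ ∣ ⟦ twin? X s ⟧ ∣ → Empty
    one-class-absurd X s {c₁} {c₂} {c₃} refl c₂-in c₃-in tri@((c₁→c₂ , _) , _) (acc smaller) =
      separator X s (vertex-twin X s) c₂-in (arc⇒≢ T c₁→c₂) (shrunk ∘ separator⇒shrinker)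
      where
      shrunk : Shrinker X s → Empty
      shrunk sh = next (twin? X′ s c₂) (twin? X′ s c₃)
        where
        open Shrinker sh
        open Shrinking sh using (X′)
        x′s≡c₁ : vertex X′ s ≡ c₁
        x′s≡c₁ = swap-off X w-twin s≢t
        c₁-in′ : Twin X′ s c₁
        c₁-in′ = subst (Twin X′ s) x′s≡c₁ (vertex-twin X′ s)
        other-class : ∀ {u} → ¬ Twin X′ s u → ∃ λ r → s ≢ r × Twin X′ r u
        other-class {u} u-out with all-twinned X′ u
        ... | r , u-twin = r , (λ { refl → u-out u-twin }) , u-twin
        next : Dec (Twin X′ s c₂) → Dec (Twin X′ s c₃) → Empty
        next (no c₂-out) _ =
          let r , s≢r , c₂-twin = other-class c₂-out in distinct-classes-absurd X′ s≢r c₁-in′ c₂-twin tri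
        next (yes _) (no c₃-out) =
          let r , s≢r , c₃-twin = other-class c₃-out in
          distinct-classes-absurd X′ (s≢r ∘ sym) c₃-twin c₁-in′ (rotate (rotate tri))
        next (yes c₂-in′) (yes c₃-in′) =
          one-class-absurd X′ s x′s≡c₁ c₂-in′ c₃-in′ tri (smaller (p⊂q⇒∣p∣<∣q∣ (Shrinking.shrink sh)))

  copy-and-triangle-absurd : Copy → ∃ (UniformTriangle (arc T)) → Empty
  copy-and-triangle-absurd X (d , c₁ , c₂ , c₃ , cyclic , (d₂ , d₃)) =
    classes (all-twinned X c₁) (all-twinned X c₂) (all-twinned X c₃)
    where
    open Apex d (arc T d c₁)
    tri : Triangle c₁ c₂ c₃
    tri = cyclic , refl , d₂ , d₃
    classes : Twinned X c₁ → Twinned X c₂ → Twinned X c₃ → Empty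
    classes (s₁ , c₁-in) (s₂ , c₂-in) (s₃ , c₃-in) with s₁ ≟ s₂ | s₂ ≟ s₃
    ... | no s₁≢s₂ | _        = distinct-classes-absurd X s₁≢s₂ c₁-in c₂-in tri
    ... | yes refl | no s₂≢s₃ = distinct-classes-absurd X s₂≢s₃ c₂-in c₃-in (rotate tri)
    ... | yes refl | yes refl = one-class-absurd (swap X c₁-in) s₁ (swap-at X c₁-in)
                                  (Twin-swap X c₁-in c₂-in) (Twin-swap X c₁-in c₃-in) tri (<-wellFounded _)

-- Containing F is decidable, so it suffices to refute its absence.
certified-embeds : (T : Tournament n) → Indecomposable T → DiamondEmbeds T → Embeds t₅ T →
                   {F : Arcs 5} → Certificate F → Embeds F T
certified-embeds T indecomposable (D , D-diamond , D↪T) t₅↪T certificate =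
  ↪⇒Embeds {T = T} (decidable-stable (_ ↪? arc T) λ no-F →
    Argument.copy-and-triangle-absurd T indecomposable certificate no-F (Embeds⇒↪ {T = T} t₅↪T)
      (let x , triangle = diamond-triangle D D-diamond in _ , UniformTriangle-↪ (Embeds⇒↪ {T = T} D↪T) triangle))

theorem3 : {n : ℕ} (T : Tournament n) → Indecomposable T →
    DiamondEmbeds T → Embeds (arcT 2) T →
    Embeds (arcU 2) T × Embeds (arcW 2) T
theorem3 T indecomposable diamond t₅↪T =
  certified-embeds T indecomposable diamond t₅↪T certificate-U ,
  certified-embeds T indecomposable diamond t₅↪T certificate-W
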